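{- Let $f$ be an AC symbol over a finite set $C$ of constants, $\gg_f$ a total admissible ordering on $f$-monomials extending a total ordering $\gg_C$ on $C$ in which every nonconstant $f$-monomial is greater than every constant, $R_f$ a canonical AC rewrite system on $f$-monomials oriented by $\gg_f$, and $R_C$ a canonical rewrite system of constant rules oriented by $\gg_C$. Let $S_f=\{l=r\mid l\rightarrow r\in R_f\}$ and $S_C=\{c=d\mid c\rightarrow d\in R_C\}$. Then the rewrite system $R'_f$ computed by ${\bf update}_{AC}(R_f,R_C,\gg_f)$ is a canonical rewrite system for $ACCC(S_f\cup S_C)$ with respect to $\gg_f$: it is terminating and confluent and, for all $f$-monomials $s,t$, $s=t\in ACCC(S_f\cup S_C)$ iff $s,t$ have the same normal form with respect to $R'_f$.
   Context: $f$-monomials: $f(M)$, $M$ a nonempty finite multiset over $C$; a constant $c$ is identified with $f(\{\!\{c\}\!\})$. On multisets $\cup$ is multiset sum, $\cap$ multiset intersection, $-$ truncated difference, $\subseteq$ sub-multiset. A rule $f(A)\rightarrow f(B)$ rewrites $f(M)$ to $f((M-A)\cup B)$ when $A\subseteq M$. Admissible: total well-founded ordering with $f(A)\gg_f f(B)$ when $B$ is a proper sub-multiset of $A$ and $f(A_1)\gg_f f(A_2)\Rightarrow f(A_1\cup B)\gg_f f(A_2\cup B)$. $ACCC(E)$: smallest equivalence relation on $f$-monomials containing $E$ such that $f(M_1)=f(M_2)$, $f(N_1)=f(N_2)$ in it imply $f(M_1\cup N_1)=f(M_2\cup N_2)$ in it. Critical pair of distinct rules $f(A_1)\rightarrow f(A_2)$,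 $f(B_1)\rightarrow f(B_2)$: $(f((AB-A_1)\cup A_2),f((AB-B_1)\cup B_2))$ with $AB=(A_1\cup B_1)-(A_1\cap B_1)$. $NF(t,R)$ denotes a normal form of $t$ w.r.t. $R$. Procedure ${\bf update}_{AC}(R_f,R_C,\gg_f)$: Let $S:=\{l=r\mid l\rightarrow r\in R_f,\ NF(l,R_C)\ne l\}$; remove these rules from $R_f$; $R'_f:=R_C\cup R_f$; $NR_C:=\emptyset$. While $S\ne\emptyset$: set $T:=\emptyset$; for each $l=r\in S$: remove it from $S$; if $NF(l,R'_f)\ne NF(r,R'_f)$, orient the pair of these normal forms by $\gg_f$ as $l'\rightarrow r'$; for each rule $l''\rightarrow r''\in R'_f$ compute their critical pair $(s_1,s_2)$ and, if $NF(s_1,R'_f)\ne NF(s_2,R'_f)$, add $NF(s_1,R'_f)=NF(s_2,R'_f)$ to $T$; add $l'\rightarrow r'$ to $R'_f$; interreduce the other rules of $R'_f$ by $l'\rightarrow r'$ (rules whose left side becomes reducible are removed and their equations put into $T$; rules where only the right side is reducible get a normalized right side); if $l'\rightarrow r'$ is a new constant rule, add it to $NR_C$. After the loop over $S$, set $S:=T$. Return $(R'_f,NR_C)$. -}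

module Defs where

open import Level using (0ℓ)
open import Data.Nat using (ℕ; _+_; _∸_; _⊓_; _≤_; _<_)
open import Data.Fin using (Fin)
open import Data.Vec using (Vec; zipWith; replicate; lookup; sum; _[_]≔_)
open import Data.List using (List; []; _∷_; _++_; map)
open import Data.List.Membership.Propositional using (_∈_)
open import Data.List.Relation.Binary.Permutation.Propositional using (_↭_)
open import Data.Product using (Σ; ∃; ∃₂; _×_; _,_; proj₁; proj₂)
open import Data.Sum using (_⊎_)
open import Relation.Binary.Core using (Rel)
open import Relation.Binary.PropositionalEquality using (_≡_; _≢_)
open import Relation.Nullary using (¬_)
open import Relation.Binary.Construct.Closure.ReflexiveTransitive using (Star)
open import Induction.WellFounded using (Acc)

private variable n : ℕ

-- Finite multisets over the constant set C = Fin n, as count vectors.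

Mset : ℕ → Set
Mset n = Vec ℕ n

infixl 6 _∪_ _−_
infixl 7 _∩_
infix 4 _⊆_

_∪_ : Mset n → Mset n → Mset n
A ∪ B = zipWith _+_ A B

_∩_ : Mset n → Mset n → Mset n
A ∩ B = zipWith _⊓_ A B

_−_ : Mset n → Mset n → Mset n
A − B = zipWith _∸_ A B

_⊆_ : Mset n → Mset n → Set
A ⊆ B = ∀ i → lookup A i ≤ lookup B i

-- the multiset {{c}}; the constant c is identified with f({{c}})
single : Fin n → Mset n
single c = replicate _ 0 [ c ]≔ 1

-- f(M) is an f-monomial iff M is nonempty
NonEmpty : Mset n → Set
NonEmpty M = 0 < sum M

IsConstant : Mset n → Set
IsConstant M = ∃ λ c → M ≡ single c

-- Rewrite systems on f-monomials (f(M) represented by M)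

Rule : ℕ → Set
Rule n = Mset n × Mset n

System : ℕ → Set
System n = List (Rule n)

Step : System n → Mset n → Mset n → Set
Step R M N = ∃₂ λ A B → (A , B) ∈ R × A ⊆ M × N ≡ (M − A) ∪ B

Steps : System n → Mset n → Mset n → Set
Steps R = Star (Step R)

Reducible : System n → Mset n → Set
Reducible R M = ∃ λ N → Step R M N

IsNF : System n → Mset n → Mset n → Set
IsNF R t u = Steps R t u × ¬ Reducible R u

SameNF : System n → Mset n → Mset n → Set
SameNF R s t = ∃ λ u → IsNF R s u × IsNF R t u

Oriented : Rel (Mset n) 0ℓ → System n → Set
Oriented _≫_ R = ∀ {l r} → (l , r) ∈ R → NonEmpty l × NonEmpty r × l ≫ r

Terminating : System n → Set
Terminating R = ∀ M → NonEmpty M → Acc (λ N M' → Step R M' N) M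

Confluent : System n → Set
Confluent R = ∀ {M N₁ N₂} → NonEmpty M → Steps R M N₁ → Steps R M N₂ →
              ∃ λ P → Steps R N₁ P × Steps R N₂ P

Canonical : Rel (Mset n) 0ℓ → System n → Set
Canonical _≫_ R = Oriented _≫_ R × Terminating R × Confluent R

record StrictTotal {A : Set} (_>_ : Rel A 0ℓ) : Set where
  field
    irrefl : ∀ {x} → ¬ (x > x)
    trans  : ∀ {x y z} → x > y → y > z → x > z
    total  : ∀ x y → x ≢ y → (x > y) ⊎ (y > x)

record Admissible {n} (_≫_ : Rel (Mset n) 0ℓ) : Set where
  field
    irrefl : ∀ {M} → NonEmpty M → ¬ (M ≫ M)
    trans  : ∀ {M N P} → NonEmpty M → NonEmpty N → NonEmpty P →
             M ≫ N → N ≫ P → M ≫ P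
    total  : ∀ M N → NonEmpty M → NonEmpty N → M ≢ N → (M ≫ N) ⊎ (N ≫ M)
    wf     : ∀ M → NonEmpty M → Acc (λ N M' → NonEmpty N × M' ≫ N) M
    proper : ∀ A B → NonEmpty B → B ⊆ A → B ≢ A → A ≫ B
    compat : ∀ A₁ A₂ B → NonEmpty A₁ → NonEmpty A₂ → A₁ ≫ A₂ →
             (A₁ ∪ B) ≫ (A₂ ∪ B)

Extends : Rel (Fin n) 0ℓ → Rel (Mset n) 0ℓ → Set
Extends _>C_ _≫_ = ∀ c d → ((c >C d) → (single c ≫ single d)) × ((single c ≫ single d) → (c >C d))

ConstantsLowest : Rel (Mset n) 0ℓ → Set
ConstantsLowest _≫_ = ∀ M c → NonEmpty M → ¬ IsConstant M → M ≫ single c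

ConstStep : List (Fin n × Fin n) → Fin n → Fin n → Set
ConstStep RC c d = (c , d) ∈ RC

CanonicalConst : Rel (Fin n) 0ℓ → List (Fin n × Fin n) → Set
CanonicalConst _>C_ RC =
  (∀ {c d} → (c , d) ∈ RC → c >C d) ×
  (∀ c → Acc (λ d c' → ConstStep RC c' d) c) ×
  (∀ {c d₁ d₂} → Star (ConstStep RC) c d₁ → Star (ConstStep RC) c d₂ →
     ∃ λ e → Star (ConstStep RC) d₁ e × Star (ConstStep RC) d₂ e)

constSys : List (Fin n × Fin n) → System n
constSys RC = map (λ cd → single (proj₁ cd) , single (proj₂ cd)) RC

data ACCC {n} (E : List (Mset n × Mset n)) : Mset n → Mset n → Set where
  base  : ∀ {s t} → (s , t) ∈ E → ACCC E s t
  refl  : ∀ {M} → NonEmpty M → ACCC E M M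
  sym   : ∀ {s t} → ACCC E s t → ACCC E t s
  trans : ∀ {s t u} → ACCC E s t → ACCC E t u → ACCC E s u
  union : ∀ {M₁ M₂ N₁ N₂} → ACCC E M₁ M₂ → ACCC E N₁ N₂ →
          ACCC E (M₁ ∪ N₁) (M₂ ∪ N₂)

-- The procedure update_AC, as a (nondeterministic) relation between
-- inputs and possible outputs R'_f.

Eqn : ℕ → Set
Eqn n = Mset n × Mset n

cp : Rule n → Rule n → Eqn n
cp (A₁ , A₂) (B₁ , B₂) =
  let AB = (A₁ ∪ B₁) − (A₁ ∩ B₁) in ((AB − A₁) ∪ A₂ , (AB − B₁) ∪ B₂)

data Split {n} (RC : System n) : System n → System n → List (Eqn n) → Set where
  []   : Split RC [] [] []
  move : ∀ {l r R K S} → Reducible RC l → Split RC R K S →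
         Split RC ((l , r) ∷ R) K ((l , r) ∷ S)
  keep : ∀ {l r R K S} → ¬ Reducible RC l → Split RC R K S →
         Split RC ((l , r) ∷ R) ((l , r) ∷ K) S

data Orient {n} (_≫_ : Rel (Mset n) 0ℓ) (u v : Mset n) : Mset n → Mset n → Set where
  lr : u ≫ v → Orient _≫_ u v u v
  rl : v ≫ u → Orient _≫_ u v v u

data CPs {n} (R : System n) (ρ : Rule n) : System n → List (Eqn n) → Set where
  []   : CPs R ρ [] []
  join : ∀ {σ Rs T u} → IsNF R (proj₁ (cp σ ρ)) u → IsNF R (proj₂ (cp σ ρ)) u →
         CPs R ρ Rs T → CPs R ρ (σ ∷ Rs) T
  add  : ∀ {σ Rs T u₁ u₂} → IsNF R (proj₁ (cp σ ρ)) u₁ → IsNF R (proj₂ (cp σ ρ)) u₂ →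
         u₁ ≢ u₂ → CPs R ρ Rs T → CPs R ρ (σ ∷ Rs) ((u₁ , u₂) ∷ T)

data Collapse {n} (l' : Mset n) : System n → System n → List (Eqn n) → Set where
  []   : Collapse l' [] [] []
  out  : ∀ {l r R K E} → l' ⊆ l → Collapse l' R K E →
         Collapse l' ((l , r) ∷ R) K ((l , r) ∷ E)
  stay : ∀ {l r R K E} → ¬ (l' ⊆ l) → Collapse l' R K E →
         Collapse l' ((l , r) ∷ R) ((l , r) ∷ K) E

data Compose {n} (Rn : System n) (l' : Mset n) : System n → System n → Set where
  []   : Compose Rn l' [] []
  norm : ∀ {l r u R K} → l' ⊆ r → IsNF Rn r u → Compose Rn l' R K →
         Compose Rn l' ((l , r) ∷ R) ((l , u) ∷ K)
  same : ∀ {l r R K} → ¬ (l' ⊆ r) → Compose Rn l' R K →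
         Compose Rn l' ((l , r) ∷ R) ((l , r) ∷ K)

data Process {n} (_≫_ : Rel (Mset n) 0ℓ) (R : System n) : Eqn n → System n → List (Eqn n) → Set where
  trivial : ∀ {l r u} → IsNF R l u → IsNF R r u → Process _≫_ R (l , r) R []
  orient  : ∀ {l r u v l' r' T₁ K T₂ K'} →
            IsNF R l u → IsNF R r v → u ≢ v → Orient _≫_ u v l' r' →
            CPs R (l' , r') R T₁ →
            Collapse l' R K T₂ →
            Compose ((l' , r') ∷ K) l' K K' →
            Process _≫_ R (l , r) ((l' , r') ∷ K') (T₁ ++ T₂)

-- the while loop; state (R'_f, S, T); terminates with output R'_f
data Loop {n} (_≫_ : Rel (Mset n) 0ℓ) : System n → List (Eqn n) → List (Eqn n) → System n → Set where
  done : ∀ {R} → Loop _≫_ R [] [] R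
  pass : ∀ {R e T R'} → Loop _≫_ R (e ∷ T) [] R' → Loop _≫_ R [] (e ∷ T) R'
  pick : ∀ {R S S' e T R₁ T₁ R'} → S ↭ (e ∷ S') → Process _≫_ R e R₁ T₁ →
         Loop _≫_ R₁ S' (T ++ T₁) R' → Loop _≫_ R S T R'

UpdateAC : Rel (Mset n) 0ℓ → System n → List (Fin n × Fin n) → System n → Set
UpdateAC _≫_ Rf RC R' =
  ∃₂ λ K S → Split (constSys RC) Rf K S × Loop _≫_ (constSys RC ++ K) S [] R'

-- update_AC is Knuth–Bendix completion of AC monomials, and we prove the completion invariant
-- in the style of Bachmair: the rules R are oriented by ≫, R together with the pending
-- equations E generates exactly ACCC(S_f ∪ S_C), and every peak of R is connected by an
-- R ∪ E-conversion all of whose terms lie below the peak. Initially this holds because R_f is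
-- canonical, R_C is locally confluent, and a kept rule of R_f has no R_C-reducible constant in its
-- left side, so its steps commute with constant steps. Each processed equation preserves it: the
-- equation is replaced by the derivations to its normal forms and the new rule, collapsed rules
-- become equations, composed rules are simulated by smaller proofs, and the only new peaks,
-- overlaps of the new rule with old left sides, are covered by the critical pairs added to E.
-- When E is empty, R terminates because ≫ is well founded, is confluent because all its peaks
-- are connected below, and so its normal forms decide ACCC(S_f ∪ S_C).

module Submission where

open import Level using (0ℓ)
open import Function using (_∘_)
open import Data.Empty using (⊥-elim)
open import Data.Nat using (ℕ; zero; suc; _+_; _∸_; _⊓_; _⊔_; _≤_; _<_; z≤n; s≤s; _≤?_; _<?_)
open import Data.Nat.Properties hiding (_≟_)
open import Data.Fin using (Fin; zero; suc; _≟_)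
open import Data.Fin.Properties using (all?)
open import Data.Vec using ([]; _∷_; lookup; sum; replicate)
open import Data.Vec.Properties
  using (lookup-zipWith; lookup∘update; lookup∘update′; lookup-replicate)
open import Data.List using (List; []; _∷_; _++_)
open import Data.List.Membership.Propositional using (_∈_)
open import Data.List.Membership.Propositional.Properties using (∈-++⁺ˡ; ∈-++⁺ʳ; ∈-++⁻; ∈-map⁺; ∈-map⁻)
open import Data.List.Relation.Unary.Any using (here; there)
open import Data.List.Properties using (++-assoc; ++-identityʳ)
open import Data.List.Relation.Binary.Permutation.Propositional using (_↭_; ↭-sym)
open import Data.List.Relation.Binary.Permutation.Propositional.Properties using (∈-resp-↭; ++⁺ʳ)
open import Data.Product using (∃; ∃₂; _×_; _,_; proj₁; proj₂; swap)
  renaming (map₁ to ×-map₁; map₂ to ×-map₂)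
open import Data.Sum using (_⊎_; inj₁; inj₂; map₁; map₂)
open import Relation.Binary.Core using (Rel)
open import Relation.Binary.PropositionalEquality
open import Relation.Nullary using (¬_; Dec; yes; no)
open import Relation.Binary.Construct.Closure.ReflexiveTransitive as Star using (Star; ε; _◅_; _◅◅_)
open import Relation.Binary.Construct.Closure.Symmetric using (fwd; bwd)
open import Relation.Binary.Construct.Closure.Equivalence as EqClosure using (EqClosure; _⋆)
open import Induction.WellFounded using (WellFounded; Acc; acc; acc-inverse; module Subrelation)
open import Defs hiding (refl; sym; trans; union; base)

private variable n : ℕ

-- Multisets

lookup-∪ : (A B : Mset n) (i : Fin n) → lookup (A ∪ B) i ≡ lookup A i + lookup B i
lookup-∪ A B i = lookup-zipWith _+_ i A B

lookup-− : (A B : Mset n) (i : Fin n) → lookup (A − B) i ≡ lookup A i ∸ lookup B i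
lookup-− A B i = lookup-zipWith _∸_ i A B

lookup-∩ : (A B : Mset n) (i : Fin n) → lookup (A ∩ B) i ≡ lookup A i ⊓ lookup B i
lookup-∩ A B i = lookup-zipWith _⊓_ i A B

⊆-refl : (A : Mset n) → A ⊆ A
⊆-refl A i = ≤-refl

⊆-trans : {A B C : Mset n} → A ⊆ B → B ⊆ C → A ⊆ C
⊆-trans p q i = ≤-trans (p i) (q i)

⊆-∪ˡ : (A B : Mset n) → A ⊆ A ∪ B
⊆-∪ˡ A B i rewrite lookup-∪ A B i = m≤m+n _ _

⊆-∪ʳ : (A B : Mset n) → B ⊆ A ∪ B
⊆-∪ʳ A B i rewrite lookup-∪ A B i = m≤n+m _ _

∪⊆⇒⊆− : (A B : Mset n) {M : Mset n} → A ∪ B ⊆ M → B ⊆ M − A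
∪⊆⇒⊆− A B {M} p i rewrite lookup-− M A i =
  m+n≤o⇒m≤o∸n (lookup B i) {lookup A i}
    (subst (_≤ lookup M i) (trans (lookup-∪ A B i) (+-comm (lookup A i) (lookup B i))) (p i))

∪-comm : (A B : Mset n) → A ∪ B ≡ B ∪ A
∪-comm [] [] = refl
∪-comm (x ∷ A) (y ∷ B) = cong₂ _∷_ (+-comm x y) (∪-comm A B)

[M−A]∪A≡M : {A M : Mset n} → A ⊆ M → (M − A) ∪ A ≡ M
[M−A]∪A≡M {A = []} {[]} _ = refl
[M−A]∪A≡M {A = x ∷ A} {y ∷ M} p = cong₂ _∷_ (m∸n+n≡m (p zero)) ([M−A]∪A≡M (p ∘ suc))

[A−A]∪B≡B : (A B : Mset n) → (A − A) ∪ B ≡ B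
[A−A]∪B≡B [] [] = refl
[A−A]∪B≡B (x ∷ A) (y ∷ B) = cong₂ _∷_ (cong (_+ y) (n∸n≡0 x)) ([A−A]∪B≡B A B)

[C∪M−A]∪B≡C∪[M−A∪B] : (C : Mset n) {M A : Mset n} (B : Mset n) → A ⊆ M →
                       ((C ∪ M) − A) ∪ B ≡ C ∪ ((M − A) ∪ B)
[C∪M−A]∪B≡C∪[M−A∪B] [] {[]} {[]} [] _ = refl
[C∪M−A]∪B≡C∪[M−A∪B] (c ∷ C) {x ∷ M} {a ∷ A} (b ∷ B) p = cong₂ _∷_
  (trans (cong (_+ b) (+-∸-assoc c (p zero))) (+-assoc c (x ∸ a) b))
  ([C∪M−A]∪B≡C∪[M−A∪B] C B (p ∘ suc))

-- Rewriting M by A → B factors through any intermediate L with A ⊆ L ⊆ M.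
[M−A]∪B≡[M−L]∪[L−A∪B] : {A L M : Mset n} (B : Mset n) → A ⊆ L → L ⊆ M →
                         (M − A) ∪ B ≡ (M − L) ∪ ((L − A) ∪ B)
[M−A]∪B≡[M−L]∪[L−A∪B] {A = []} {[]} {[]} [] _ _ = refl
[M−A]∪B≡[M−L]∪[L−A∪B] {A = a ∷ A} {l ∷ L} {m ∷ M} (b ∷ B) p q = cong₂ _∷_
  (begin
    m ∸ a + b                ≡⟨ cong (λ k → k ∸ a + b) (m∸n+n≡m (q zero)) ⟨
    (m ∸ l + l) ∸ a + b      ≡⟨ cong (_+ b) (+-∸-assoc (m ∸ l) (p zero)) ⟩
    m ∸ l + (l ∸ a) + b      ≡⟨ +-assoc (m ∸ l) (l ∸ a) b ⟩
    m ∸ l + (l ∸ a + b)      ∎)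
  ([M−A]∪B≡[M−L]∪[L−A∪B] B (p ∘ suc) (q ∘ suc))
  where open ≡-Reasoning

-- Two rewrites whose left sides occur disjointly in M commute.
[[M−A]∪A′−B]∪B′-comm : (A B : Mset n) {M : Mset n} (A′ B′ : Mset n) → A ∪ B ⊆ M →
                       (((M − A) ∪ A′) − B) ∪ B′ ≡ (((M − B) ∪ B′) − A) ∪ A′
[[M−A]∪A′−B]∪B′-comm [] [] {[]} [] [] _ = refl
[[M−A]∪A′−B]∪B′-comm (a ∷ A) (b ∷ B) {m ∷ M} (a′ ∷ A′) (b′ ∷ B′) p = cong₂ _∷_
  (begin
    (m ∸ a + a′) ∸ b + b′    ≡⟨ cong (_+ b′) (+-∸-comm a′ (m+n≤o⇒m≤o∸n b b+a≤m)) ⟩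
    m ∸ a ∸ b + a′ + b′      ≡⟨ cong (λ k → k + a′ + b′) (trans (∸-+-assoc m a b) (cong (m ∸_) (+-comm a b))) ⟩
    m ∸ (b + a) + a′ + b′    ≡⟨ +-assoc (m ∸ (b + a)) a′ b′ ⟩
    m ∸ (b + a) + (a′ + b′)  ≡⟨ cong (m ∸ (b + a) +_) (+-comm a′ b′) ⟩
    m ∸ (b + a) + (b′ + a′)  ≡⟨ +-assoc (m ∸ (b + a)) b′ a′ ⟨
    m ∸ (b + a) + b′ + a′    ≡⟨ cong (λ k → k + b′ + a′) (∸-+-assoc m b a) ⟨
    m ∸ b ∸ a + b′ + a′      ≡⟨ cong (_+ a′) (+-∸-comm b′ (m+n≤o⇒m≤o∸n a (p zero))) ⟨
    (m ∸ b + b′) ∸ a + a′    ∎)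
  ([[M−A]∪A′−B]∪B′-comm A B A′ B′ (p ∘ suc))
  where
  open ≡-Reasoning
  b+a≤m : b + a ≤ m
  b+a≤m = subst (_≤ m) (+-comm a b) (p zero)

⊆? : (A M : Mset n) → Dec (A ⊆ M)
⊆? A M = all? (λ i → lookup A i ≤? lookup M i)

lcm : Mset n → Mset n → Mset n
lcm A B = (A ∪ B) − (A ∩ B)

lookup-lcm : (A B : Mset n) (i : Fin n) → lookup (lcm A B) i ≡ lookup A i ⊔ lookup B i
lookup-lcm A B i rewrite lookup-− (A ∪ B) (A ∩ B) i | lookup-∪ A B i | lookup-∩ A B i
  with ≤-total (lookup A i) (lookup B i)
... | inj₁ a≤b rewrite m≤n⇒m⊓n≡m a≤b | m≤n⇒m⊔n≡n a≤b = m+n∸m≡n (lookup A i) (lookup B i)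
... | inj₂ b≤a rewrite m≥n⇒m⊓n≡n b≤a | m≥n⇒m⊔n≡m b≤a = m+n∸n≡m (lookup A i) (lookup B i)

⊆-lcmˡ : (A B : Mset n) → A ⊆ lcm A B
⊆-lcmˡ A B i rewrite lookup-lcm A B i = m≤m⊔n _ _

⊆-lcmʳ : (A B : Mset n) → B ⊆ lcm A B
⊆-lcmʳ A B i rewrite lookup-lcm A B i = m≤n⊔m _ _

lcm-least : {A B M : Mset n} → A ⊆ M → B ⊆ M → lcm A B ⊆ M
lcm-least {A = A} {B} p q i rewrite lookup-lcm A B i = ⊔-lub (p i) (q i)

sum-∪ : (A B : Mset n) → sum (A ∪ B) ≡ sum A + sum B
sum-∪ [] [] = refl
sum-∪ (x ∷ A) (y ∷ B) rewrite sum-∪ A B = +-comm-middle x y (sum A) (sum B)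
  where
  +-comm-middle : ∀ a b c d → a + b + (c + d) ≡ a + c + (b + d)
  +-comm-middle a b c d = trans (+-assoc a b (c + d)) (trans (cong (a +_) (trans (sym (+-assoc b c d))
    (trans (cong (_+ d) (+-comm b c)) (+-assoc c b d)))) (sym (+-assoc a c (b + d))))

sum-mono : {A B : Mset n} → A ⊆ B → sum A ≤ sum B
sum-mono {A = []} {[]} _ = ≤-refl
sum-mono {A = x ∷ A} {y ∷ B} p = +-mono-≤ (p zero) (sum-mono {A = A} {B} (p ∘ suc))

NonEmpty-⊆ : {A M : Mset n} → A ⊆ M → NonEmpty A → NonEmpty M
NonEmpty-⊆ {A = A} {M} p neA = <-≤-trans neA (sum-mono {A = A} {M} p)

NonEmpty-∪ˡ : (A B : Mset n) → NonEmpty A → NonEmpty (A ∪ B)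
NonEmpty-∪ˡ A B = NonEmpty-⊆ {A = A} {A ∪ B} (⊆-∪ˡ A B)

NonEmpty-∪ʳ : (A B : Mset n) → NonEmpty B → NonEmpty (A ∪ B)
NonEmpty-∪ʳ A B = NonEmpty-⊆ {A = B} {A ∪ B} (⊆-∪ʳ A B)

NonEmpty? : (M : Mset n) → Dec (NonEmpty M)
NonEmpty? M = 0 <? sum M

∪-identityˡ : {E : Mset n} (A : Mset n) → ¬ NonEmpty E → E ∪ A ≡ A
∪-identityˡ {E = []} [] _ = refl
∪-identityˡ {E = zero ∷ E} (a ∷ A) empty = cong (a ∷_) (∪-identityˡ A empty)
∪-identityˡ {E = suc _ ∷ _} (_ ∷ _) empty = ⊥-elim (empty (s≤s z≤n))

A≢A∪B : (A B : Mset n) → NonEmpty B → A ≢ A ∪ B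
A≢A∪B A B neB A≡A∪B = <-irrefl refl (begin-strict
  sum A              <⟨ m<m+n (sum A) neB ⟩
  sum A + sum B      ≡⟨ sum-∪ A B ⟨
  sum (A ∪ B)        ≡⟨ cong sum A≡A∪B ⟨
  sum A              ∎)
  where open ≤-Reasoning

lookup-single : (c : Fin n) → lookup (single c) c ≡ 1
lookup-single c = lookup∘update c (replicate _ 0) 1

lookup-single-≢ : (c : Fin n) {i : Fin n} → i ≢ c → lookup (single c) i ≡ 0
lookup-single-≢ c {i} i≢c = trans (lookup∘update′ i≢c (replicate _ 0) 1) (lookup-replicate i 0)

NonEmpty-lookup : (M : Mset n) (i : Fin n) → 0 < lookup M i → NonEmpty M
NonEmpty-lookup (x ∷ M) zero p = ≤-trans p (m≤m+n x (sum M))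
NonEmpty-lookup (x ∷ M) (suc i) p = ≤-trans (NonEmpty-lookup M i p) (m≤n+m (sum M) x)

NonEmpty-single : (c : Fin n) → NonEmpty (single c)
NonEmpty-single c = NonEmpty-lookup (single c) c (subst (0 <_) (sym (lookup-single c)) (s≤s z≤n))

single⊆ : (c : Fin n) {M : Mset n} → 1 ≤ lookup M c → single c ⊆ M
single⊆ c {M} p i with i ≟ c
... | yes refl = subst (_≤ lookup M c) (sym (lookup-single c)) p
... | no i≢c = subst (_≤ lookup M i) (sym (lookup-single-≢ c i≢c)) z≤n

single∪⊆ : (c : Fin n) {B M : Mset n} → single c ⊆ M → B ⊆ M → ¬ single c ⊆ B → single c ∪ B ⊆ M
single∪⊆ c {B} {M} c⊆M B⊆M c⊈B i rewrite lookup-∪ (single c) B i with i ≟ c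
... | no i≢c rewrite lookup-single-≢ c i≢c = B⊆M i
... | yes refl with lookup B c in eq
...   | zero rewrite +-identityʳ (lookup (single c) c) = c⊆M c
...   | suc _ = ⊥-elim (c⊈B (single⊆ c {B} (subst (1 ≤_) (sym eq) (s≤s z≤n))))

single⊆single⇒≡ : {c c′ : Fin n} → single c ⊆ single c′ → c ≡ c′
single⊆single⇒≡ {c = c} {c′} p with c ≟ c′
... | yes c≡c′ = c≡c′
... | no c≢c′ with subst₂ _≤_ (lookup-single c) (lookup-single-≢ c′ c≢c′) (p c)
...   | ()

∈-Split⁻ : ∀ {RC Rf K S} {e : Rule n} → Split RC Rf K S → e ∈ Rf → e ∈ K ⊎ e ∈ S
∈-Split⁻ (move _ s) (here refl) = inj₂ (here refl)
∈-Split⁻ (keep _ s) (here refl) = inj₁ (here refl)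
∈-Split⁻ (move _ s) (there m) = map₂ there (∈-Split⁻ s m)
∈-Split⁻ (keep _ s) (there m) = map₁ there (∈-Split⁻ s m)

∈-Split-kept : ∀ {RC Rf K S} {l r : Mset n} → Split RC Rf K S → (l , r) ∈ K →
               (l , r) ∈ Rf × ¬ Reducible RC l
∈-Split-kept (move _ s) m = ×-map₁ there (∈-Split-kept s m)
∈-Split-kept (keep ¬red _) (here refl) = here refl , ¬red
∈-Split-kept (keep _ s) (there m) = ×-map₁ there (∈-Split-kept s m)

∈-Split-moved : ∀ {RC Rf K S} {e : Rule n} → Split RC Rf K S → e ∈ S → e ∈ Rf
∈-Split-moved (move _ s) (here refl) = here refl
∈-Split-moved (move _ s) (there m) = there (∈-Split-moved s m)
∈-Split-moved (keep _ s) m = there (∈-Split-moved s m)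

∈-Collapse⁻ : ∀ {l′ R K T} {e : Rule n} → Collapse l′ R K T → e ∈ R → e ∈ K ⊎ e ∈ T
∈-Collapse⁻ (out _ c) (here refl) = inj₂ (here refl)
∈-Collapse⁻ (stay _ c) (here refl) = inj₁ (here refl)
∈-Collapse⁻ (out _ c) (there m) = map₂ there (∈-Collapse⁻ c m)
∈-Collapse⁻ (stay _ c) (there m) = map₁ there (∈-Collapse⁻ c m)

∈-Collapse-kept : ∀ {l′ R K T} {e : Rule n} → Collapse l′ R K T → e ∈ K → e ∈ R
∈-Collapse-kept (out _ c) m = there (∈-Collapse-kept c m)
∈-Collapse-kept (stay _ c) (here refl) = here refl
∈-Collapse-kept (stay _ c) (there m) = there (∈-Collapse-kept c m)

∈-Collapse-removed : ∀ {l′ R K T} {e : Rule n} → Collapse l′ R K T → e ∈ T → e ∈ R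
∈-Collapse-removed (out _ c) (here refl) = here refl
∈-Collapse-removed (out _ c) (there m) = there (∈-Collapse-removed c m)
∈-Collapse-removed (stay _ c) m = there (∈-Collapse-removed c m)

∈-Compose⁺ : ∀ {Rn l′ K K′} {l r : Mset n} → Compose Rn l′ K K′ → (l , r) ∈ K →
             ∃ λ u → (l , u) ∈ K′ × Steps Rn r u
∈-Compose⁺ (norm _ nf _) (here refl) = _ , here refl , proj₁ nf
∈-Compose⁺ (same _ _) (here refl) = _ , here refl , ε
∈-Compose⁺ (norm _ _ c) (there m) = ×-map₂ (×-map₁ there) (∈-Compose⁺ c m)
∈-Compose⁺ (same _ c) (there m) = ×-map₂ (×-map₁ there) (∈-Compose⁺ c m)

∈-Compose⁻ : ∀ {Rn l′ K K′} {l u : Mset n} → Compose Rn l′ K K′ → (l , u) ∈ K′ →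
             ∃ λ r → (l , r) ∈ K × Steps Rn r u
∈-Compose⁻ (norm _ nf _) (here refl) = _ , here refl , proj₁ nf
∈-Compose⁻ (same _ _) (here refl) = _ , here refl , ε
∈-Compose⁻ (norm _ _ c) (there m) = ×-map₂ (×-map₁ there) (∈-Compose⁻ c m)
∈-Compose⁻ (same _ c) (there m) = ×-map₂ (×-map₁ there) (∈-Compose⁻ c m)

∈-CPs⁺ : ∀ {R ρ Rs T} {σ : Rule n} → CPs R ρ Rs T → σ ∈ Rs →
         ∃₂ λ u₁ u₂ → Steps R (proj₁ (cp σ ρ)) u₁ × Steps R (proj₂ (cp σ ρ)) u₂ ×
                      (u₁ ≡ u₂ ⊎ (u₁ , u₂) ∈ T)
∈-CPs⁺ (join nf₁ nf₂ _) (here refl) = _ , _ , proj₁ nf₁ , proj₁ nf₂ , inj₁ refl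
∈-CPs⁺ (add nf₁ nf₂ _ _) (here refl) = _ , _ , proj₁ nf₁ , proj₁ nf₂ , inj₂ (here refl)
∈-CPs⁺ (join _ _ c) (there m) = ∈-CPs⁺ c m
∈-CPs⁺ (add _ _ _ c) (there m) with ∈-CPs⁺ c m
... | u₁ , u₂ , s₁ , s₂ , j = u₁ , u₂ , s₁ , s₂ , map₂ there j

∈-CPs⁻ : ∀ {R ρ Rs T} {u₁ u₂ : Mset n} → CPs R ρ Rs T → (u₁ , u₂) ∈ T →
         ∃ λ σ → σ ∈ Rs × Steps R (proj₁ (cp σ ρ)) u₁ × Steps R (proj₂ (cp σ ρ)) u₂
∈-CPs⁻ (join _ _ c) m = ×-map₂ (×-map₁ there) (∈-CPs⁻ c m)
∈-CPs⁻ (add nf₁ nf₂ _ _) (here refl) = _ , here refl , proj₁ nf₁ , proj₁ nf₂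
∈-CPs⁻ (add _ _ _ c) (there m) = ×-map₂ (×-map₁ there) (∈-CPs⁻ c m)

reducible? : (R : System n) (M : Mset n) → Dec (Reducible R M)
reducible? [] M = no λ { (_ , _ , _ , () , _) }
reducible? ((A , B) ∷ R) M with ⊆? A M | reducible? R M
... | yes A⊆M | _ = yes (_ , A , B , here refl , A⊆M , refl)
... | no _ | yes (N , A′ , B′ , m , p) = yes (N , A′ , B′ , there m , p)
... | no A⊈M | no ¬red = no λ
  { (_ , _ , _ , here refl , A⊆M , _) → A⊈M A⊆M
  ; (N , A′ , B′ , there m , p) → ¬red (N , A′ , B′ , m , p) }

normal-form : {R : System n} {M : Mset n} → Acc (λ N M′ → Step R M′ N) M → ∃ (IsNF R M)
normal-form {R = R} {M} (acc rs) with reducible? R M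
... | no irreducible = M , ε , irreducible
... | yes (N , s) with normal-form (rs s)
...   | u , N→u , irreducible = u , s ◅ N→u , irreducible

-- Rewriting with rules oriented by an admissible ordering

module Rewriting {n : ℕ} (_≫_ : Rel (Mset n) 0ℓ) (adm : Admissible _≫_) where

  private module ≫ = Admissible adm

  -- Rules given by a predicate, so that a system and a list of equations
  -- can be used together.
  RuleSet : Set₁
  RuleSet = Rule n → Set

  StepBy : RuleSet → Mset n → Mset n → Set
  StepBy P M N = ∃₂ λ A B → P (A , B) × A ⊆ M × N ≡ (M − A) ∪ B

  Conv : RuleSet → Mset n → Mset n → Set
  Conv P = EqClosure (StepBy P)

  NonEmptySides : RuleSet → Set
  NonEmptySides P = ∀ {l r} → P (l , r) → NonEmpty l × NonEmpty r

  private variable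
    P Q : RuleSet
    R : System n
    A B C M N a b s t x y : Mset n

  stepBy-map : (∀ {e} → P e → Q e) → StepBy P M N → StepBy Q M N
  stepBy-map f (A , B , p , A⊆M , eq) = A , B , f p , A⊆M , eq

  stepBy-ctx : (C : Mset n) → StepBy P M N → StepBy P (C ∪ M) (C ∪ N)
  stepBy-ctx {M = M} C (A , B , p , A⊆M , refl) =
    A , B , p , ⊆-trans {A = A} {M} {C ∪ M} A⊆M (⊆-∪ʳ C M) , sym ([C∪M−A]∪B≡C∪[M−A∪B] C B A⊆M)

  steps-ctx : (C : Mset n) → Steps R M N → Steps R (C ∪ M) (C ∪ N)
  steps-ctx C = Star.gmap (C ∪_) (stepBy-ctx C)

  conv-ctx : (C : Mset n) → Conv P M N → Conv P (C ∪ M) (C ∪ N)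
  conv-ctx C = EqClosure.gmap (C ∪_) (stepBy-ctx C)

  rule-stepBy : P (A , B) → StepBy P A B
  rule-stepBy {A = A} {B} p = A , B , p , ⊆-refl A , sym ([A−A]∪B≡B A B)

  rule-step : (C : Mset n) → P (A , B) → StepBy P (C ∪ A) (C ∪ B)
  rule-step C p = stepBy-ctx C (rule-stepBy p)

  data StepView (P : RuleSet) : Mset n → Mset n → Set where
    ctx : (C : Mset n) {A B : Mset n} → P (A , B) → StepView P (C ∪ A) (C ∪ B)

  stepView : StepBy P M N → StepView P M N
  stepView {P = P} {M = M} (A , B , p , A⊆M , refl) =
    subst (λ X → StepView P X ((M − A) ∪ B)) ([M−A]∪A≡M A⊆M) (ctx (M − A) p)

  step-nonempty : NonEmptySides P → StepBy P M N → NonEmpty M × NonEmpty N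
  step-nonempty {M = M} ne (A , B , p , A⊆M , refl) =
    NonEmpty-⊆ {A = A} {M} A⊆M (proj₁ (ne p)) , NonEmpty-∪ʳ (M − A) B (proj₂ (ne p))

  steps-nonempty : NonEmptySides (_∈ R) → NonEmpty M → Steps R M N → NonEmpty N
  steps-nonempty ne neM ε = neM
  steps-nonempty ne neM (s ◅ ss) = steps-nonempty ne (proj₂ (step-nonempty ne s)) ss

  oriented-nonempty : Oriented _≫_ R → NonEmptySides (_∈ R)
  oriented-nonempty ori m = proj₁ (ori m) , proj₁ (proj₂ (ori m))

  -- ≫ as a strict order on f-monomials; with this field order Oriented _≫_ R says r ≺ l for each rule.
  infix 4 _≺_
  _≺_ : Mset n → Mset n → Set
  a ≺ t = NonEmpty t × NonEmpty a × t ≫ a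

  ≺-trans : a ≺ b → b ≺ t → a ≺ t
  ≺-trans (nb , na , b≫a) (nt , _ , t≫b) = nt , na , ≫.trans nt nb na t≫b b≫a

  ≺-wellFounded : WellFounded _≺_
  ≺-wellFounded M = acc λ (nM , na , M≫a) → fromAdmissible (acc-inverse (≫.wf M nM) (na , M≫a))
    where
    fromAdmissible : ∀ {x} → Acc (λ N M′ → NonEmpty N × M′ ≫ N) x → Acc _≺_ x
    fromAdmissible (acc rs) = acc λ (_ , na , M≫a) → fromAdmissible (rs (na , M≫a))

  ≺-∪ˡ : NonEmpty a → NonEmpty b → a ≺ a ∪ b
  ≺-∪ˡ {a} {b} na nb = NonEmpty-∪ˡ a b na , na , ≫.proper (a ∪ b) a na (⊆-∪ˡ a b) (A≢A∪B a b nb)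

  ≺-∪ʳ : NonEmpty a → NonEmpty b → b ≺ a ∪ b
  ≺-∪ʳ {a} {b} na nb = NonEmpty-∪ʳ a b nb , nb ,
    ≫.proper (a ∪ b) b nb (⊆-∪ʳ a b) (λ b≡a∪b → A≢A∪B b a na (trans b≡a∪b (∪-comm a b)))

  ≫-ctx : (C : Mset n) → NonEmpty A → NonEmpty B → A ≫ B → (C ∪ A) ≫ (C ∪ B)
  ≫-ctx {A} {B} C neA neB A≫B =
    subst₂ _≫_ (∪-comm A C) (∪-comm B C) (≫.compat A B C neA neB A≫B)

  module _ (ori : Oriented _≫_ R) where

    step-≺ : Step R M N → N ≺ M
    step-≺ s with stepView s | step-nonempty (oriented-nonempty ori) s
    ... | ctx C p | neM , neN with ori p
    ...   | neA , neB , A≫B = neM , neN , ≫-ctx C neA neB A≫B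

    ≺-steps : a ≺ t → Steps R a b → b ≺ t
    ≺-steps a≺t ε = a≺t
    ≺-steps a≺t (s ◅ ss) = ≺-steps (≺-trans (step-≺ s) a≺t) ss

    terminating : Terminating R
    terminating M _ = Subrelation.accessible step-≺ (≺-wellFounded M)

  Orient-≺ : Orient _≫_ a b x y → NonEmpty a → NonEmpty b → y ≺ x
  Orient-≺ (lr a≫b) na nb = na , nb , a≫b
  Orient-≺ (rl b≫a) na nb = nb , na , b≫a

  module _ (S : Mset n → Mset n → Set) (sym-S : ∀ {x y} → S x y → S y x) where

    Orient⁺ : Orient _≫_ a b x y → S a b → S x y
    Orient⁺ (lr _) p = p
    Orient⁺ (rl _) p = sym-S p

    Orient⁻ : Orient _≫_ a b x y → S x y → S a b
    Orient⁻ (lr _) p = p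
    Orient⁻ (rl _) p = sym-S p

  -- conversions all of whose terms lie below t (proofs below t, in the sense of proof orderings)
  StepBelow : RuleSet → Mset n → Mset n → Mset n → Set
  StepBelow P t a b = StepBy P a b × a ≺ t × b ≺ t

  ConnBelow : RuleSet → Mset n → Mset n → Mset n → Set
  ConnBelow P t = EqClosure (StepBelow P t)

  link : StepBy P a b → a ≺ t → b ≺ t → ConnBelow P t a b
  link s a≺t b≺t = fwd (s , a≺t , b≺t) ◅ ε

  connBelow-map : (∀ {e} → P e → Q e) → ConnBelow P t a b → ConnBelow Q t a b
  connBelow-map f = EqClosure.map (×-map₁ (stepBy-map f))

  connBelow-sym : ConnBelow P t a b → ConnBelow P t b a
  connBelow-sym = EqClosure.symmetric _

  connBelow⇒conv : ConnBelow P t a b → Conv P a b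
  connBelow⇒conv = EqClosure.map proj₁

  -- The bound s on the sources of the steps may differ from the bound t of the chain.
  steps-connected : Oriented _≫_ R → (∀ {x y} → x ≺ s → Step R x y → ConnBelow Q t x y) →
                    a ≺ s → Steps R a b → ConnBelow Q t a b
  steps-connected ori conn a≺s ε = ε
  steps-connected ori conn a≺s (x ◅ xs) =
    conn a≺s x ◅◅ steps-connected ori conn (≺-trans (step-≺ ori x) a≺s) xs

  steps-connBelow : Oriented _≫_ R → (∀ {e} → e ∈ R → P e) → a ≺ t → Steps R a b → ConnBelow P t a b
  steps-connBelow ori f =
    steps-connected ori λ x≺t s → link (stepBy-map f s) x≺t (≺-trans (step-≺ ori s) x≺t)

  disjoint-peak : Oriented _≫_ R → (A , x) ∈ R → (B , y) ∈ R → A ∪ B ⊆ t →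
                  ConnBelow (_∈ R) t ((t − A) ∪ x) ((t − B) ∪ y)
  disjoint-peak {R} {A} {x} {B} {y} {t} ori Ax By AB⊆t =
    link s₁ a≺t c≺t ◅◅ connBelow-sym (link s₂ b≺t c≺t)
    where
    A⊆t = ⊆-trans {A = A} {A ∪ B} {t} (⊆-∪ˡ A B) AB⊆t
    B⊆t = ⊆-trans {A = B} {A ∪ B} {t} (⊆-∪ʳ A B) AB⊆t
    t⇒a : Step R t ((t − A) ∪ x)
    t⇒a = A , x , Ax , A⊆t , refl
    t⇒b : Step R t ((t − B) ∪ y)
    t⇒b = B , y , By , B⊆t , refl
    s₁ : Step R ((t − A) ∪ x) ((((t − A) ∪ x) − B) ∪ y)
    s₁ = B , y , By ,
         ⊆-trans {A = B} {t − A} {(t − A) ∪ x} (∪⊆⇒⊆− A B {t} AB⊆t) (⊆-∪ˡ (t − A) x) ,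
         refl
    s₂ : Step R ((t − B) ∪ y) ((((t − A) ∪ x) − B) ∪ y)
    s₂ = A , x , Ax ,
         ⊆-trans {A = A} {t − B} {(t − B) ∪ y}
           (∪⊆⇒⊆− B A {t} (subst (_⊆ t) (∪-comm A B) AB⊆t)) (⊆-∪ˡ (t − B) y) ,
         [[M−A]∪A′−B]∪B′-comm A B x y AB⊆t
    a≺t = step-≺ ori t⇒a
    b≺t = step-≺ ori t⇒b
    c≺t = ≺-trans (step-≺ ori s₁) a≺t

  Simulates : RuleSet → RuleSet → Set
  Simulates P Q = ∀ {t a b} → StepBelow P t a b → ConnBelow Q t a b

  simulate-connBelow : Simulates P Q → ConnBelow P t a b → ConnBelow Q t a b
  simulate-connBelow sim = sim ⋆

  step-below-∪ : NonEmptySides P → StepBy P a b → StepBelow P (a ∪ b) a b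
  step-below-∪ ne s = s , ≺-∪ˡ na nb , ≺-∪ʳ na nb
    where
    na = proj₁ (step-nonempty ne s)
    nb = proj₂ (step-nonempty ne s)

  simulate-conv : NonEmptySides P → Simulates P Q → Conv P a b → Conv Q a b
  simulate-conv ne sim = (connBelow⇒conv ∘ sim ∘ step-below-∪ ne) ⋆

  Joinable : System n → Mset n → Mset n → Set
  Joinable R x y = ∃ λ z → Steps R x z × Steps R y z

  PeaksConnected : System n → Set
  PeaksConnected R = ∀ {t x y} → Step R t x → Step R t y → ConnBelow (_∈ R) t x y

  confluent : Oriented _≫_ R → PeaksConnected R → Confluent R
  confluent {R} ori peaks {M} _ = confluent-at (≺-wellFounded M)
    where
    CR : Mset n → Set
    CR t = ∀ {x y} → Steps R t x → Steps R t y → Joinable R x y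

    join-below : (∀ {s} → s ≺ t → CR s) → ConnBelow (_∈ R) t x y → Joinable R x y
    join-below ih ε = _ , ε , ε
    join-below ih (fwd (s , _) ◅ c) with join-below ih c
    ... | z , x′z , yz = z , s ◅ x′z , yz
    join-below ih (bwd (s , x′≺t , _) ◅ c) with join-below ih c
    ... | z , x′z , yz with ih x′≺t (s ◅ ε) x′z
    ...   | w , xw , zw = w , xw , yz ◅◅ zw

    confluent-at : Acc _≺_ t → CR t
    confluent-at _ ε q = _ , q , ε
    confluent-at _ (s ◅ p) ε = _ , ε , s ◅ p
    confluent-at (acc rs) (s₁ ◅ p) (s₂ ◅ q)
      with join-below (λ s≺t → confluent-at (rs s≺t)) (peaks s₁ s₂)
    ... | z , x₁z , y₁z
      with confluent-at (rs (step-≺ ori s₁)) p x₁z | confluent-at (rs (step-≺ ori s₂)) q y₁z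
    ...   | w₁ , xw₁ , zw₁ | w₂ , yw₂ , zw₂
      with confluent-at (rs (≺-steps ori (step-≺ ori s₁) x₁z)) zw₁ zw₂
    ...     | w , w₁w , w₂w = w , xw₁ ◅◅ w₁w , yw₂ ◅◅ w₂w

  conv-joinable : NonEmptySides (_∈ R) → Confluent R → NonEmpty M → Conv (_∈ R) M N → Joinable R M N
  conv-joinable ne conf neM ε = _ , ε , ε
  conv-joinable ne conf neM (fwd s ◅ c) with conv-joinable ne conf (proj₂ (step-nonempty ne s)) c
  ... | z , xz , Nz = z , s ◅ xz , Nz
  conv-joinable ne conf neM (bwd s ◅ c) with conv-joinable ne conf (proj₁ (step-nonempty ne s)) c
  ... | z , xz , Nz with conf (proj₁ (step-nonempty ne s)) (s ◅ ε) xz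
  ...   | w , Mw , zw = w , Mw , Nz ◅◅ zw

  ACCC⇒conv : {E : List (Eqn n)} → (∀ {l r} → (l , r) ∈ E → Conv P l r) → ACCC E M N → Conv P M N
  ACCC⇒conv eqns (ACCC.base m) = eqns m
  ACCC⇒conv eqns (ACCC.refl _) = ε
  ACCC⇒conv eqns (ACCC.sym p) = EqClosure.symmetric _ (ACCC⇒conv eqns p)
  ACCC⇒conv eqns (ACCC.trans p q) = ACCC⇒conv eqns p ◅◅ ACCC⇒conv eqns q
  ACCC⇒conv {P = P} eqns (ACCC.union {M₁} {M₂} {N₁} {N₂} p q) =
    subst₂ (Conv P) (∪-comm N₁ M₁) (∪-comm N₁ M₂) (conv-ctx N₁ (ACCC⇒conv eqns p)) ◅◅
    conv-ctx M₂ (ACCC⇒conv eqns q)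

  module _ (E₀ : List (Eqn n)) where

    Sound : RuleSet → Set
    Sound P = ∀ {l r} → P (l , r) → ACCC E₀ l r

    step-sound : Sound P → StepBy P M N → ACCC E₀ M N
    step-sound sound s with stepView s
    ... | ctx C {A} {B} p with NonEmpty? C
    ...   | yes neC = ACCC.union (ACCC.refl neC) (sound p)
    ...   | no ¬neC = subst₂ (ACCC E₀) (sym (∪-identityˡ A ¬neC)) (sym (∪-identityˡ B ¬neC)) (sound p)

    conv-sound : Sound P → NonEmpty N → Conv P M N → ACCC E₀ M N
    conv-sound sound neN ε = ACCC.refl neN
    conv-sound sound neN (fwd s ◅ c) = ACCC.trans (step-sound sound s) (conv-sound sound neN c)
    conv-sound sound neN (bwd s ◅ c) = ACCC.trans (ACCC.sym (step-sound sound s)) (conv-sound sound neN c)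

    steps-sound : Sound (_∈ R) → NonEmpty N → Steps R M N → ACCC E₀ M N
    steps-sound sound neN ss = conv-sound sound neN (Star.map fwd ss)

-- The invariant of update_AC

module Completion {n : ℕ} (_≫_ : Rel (Mset n) 0ℓ) (adm : Admissible _≫_) (E₀ : List (Eqn n)) where

  open Rewriting _≫_ adm

  _⊕_ : System n → List (Eqn n) → RuleSet
  (R ⊕ E) e = e ∈ R ⊎ e ∈ E

  record Invariant (R : System n) (E : List (Eqn n)) : Set where
    field
      oriented      : Oriented _≫_ R
      eqns-nonempty : NonEmptySides (_∈ E)
      peaks         : ∀ {t x y} → Step R t x → Step R t y → ConnBelow (R ⊕ E) t x y
      sound         : Sound E₀ (R ⊕ E)
      complete      : ∀ {l r} → (l , r) ∈ E₀ → Conv (R ⊕ E) l r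

  private variable
    R R′ : System n
    E S T T₁ T₂ : List (Eqn n)
    e : Eqn n
    a b s t x y : Mset n

  ⊕-nonempty : Oriented _≫_ R → NonEmptySides (_∈ E) → NonEmptySides (R ⊕ E)
  ⊕-nonempty ori ne (inj₁ m) = oriented-nonempty ori m
  ⊕-nonempty ori ne (inj₂ m) = ne m

  Invariant-resp-↭ : {E E′ : List (Eqn n)} → E ↭ E′ → Invariant R E → Invariant R E′
  Invariant-resp-↭ {E = E} {E′} E↭E′ I = record
    { oriented      = oriented
    ; eqns-nonempty = eqns-nonempty ∘ back
    ; peaks         = λ s₁ s₂ → connBelow-map (map₂ forth) (peaks s₁ s₂)
    ; sound         = sound ∘ map₂ back
    ; complete      = EqClosure.map (stepBy-map (map₂ forth)) ∘ complete
    }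
    where
    open Invariant I
    forth : ∀ {e} → e ∈ E → e ∈ E′
    forth = ∈-resp-↭ E↭E′
    back : ∀ {e} → e ∈ E′ → e ∈ E
    back = ∈-resp-↭ (↭-sym E↭E′)

  module Trivial {l r u : Mset n}
      (I : Invariant R ((l , r) ∷ E)) (l→u : Steps R l u) (r→u : Steps R r u) where

    open Invariant I

    simulated : Simulates (R ⊕ ((l , r) ∷ E)) (R ⊕ E)
    simulated (s , a≺t , b≺t) with stepView s
    ... | ctx C (inj₁ m) = link (rule-step C (inj₁ m)) a≺t b≺t
    ... | ctx C (inj₂ (there m)) = link (rule-step C (inj₂ m)) a≺t b≺t
    ... | ctx C (inj₂ (here refl)) = steps-connBelow oriented inj₁ a≺t (steps-ctx C l→u) ◅◅
      connBelow-sym (steps-connBelow oriented inj₁ b≺t (steps-ctx C r→u))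

    invariant : Invariant R E
    invariant = record
      { oriented      = oriented
      ; eqns-nonempty = eqns-nonempty ∘ there
      ; peaks         = λ s₁ s₂ → simulate-connBelow simulated (peaks s₁ s₂)
      ; sound         = sound ∘ map₂ there
      ; complete      = simulate-conv (⊕-nonempty oriented eqns-nonempty) simulated ∘ complete
      }

  module Orientation {l r u v l′ r′ : Mset n} {K K′ : System n}
      (I : Invariant R ((l , r) ∷ E)) (l→u : Steps R l u) (r→v : Steps R r v)
      (o : Orient _≫_ u v l′ r′) (cps : CPs R (l′ , r′) R T₁) (col : Collapse l′ R K T₂)
      (cmp : Compose ((l′ , r′) ∷ K) l′ K K′) where

    open Invariant I

    -- the system between the collapse and the compose phase of interreduction
    Rn : System n
    Rn = (l′ , r′) ∷ K

    R₁ : System n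
    R₁ = (l′ , r′) ∷ K′

    E₁ : List (Eqn n)
    E₁ = E ++ (T₁ ++ T₂)

    New : RuleSet
    New = R₁ ⊕ E₁

    ρ∈New : New (l′ , r′)
    ρ∈New = inj₁ (here refl)

    ∈-E₁⁻ : e ∈ E₁ → e ∈ E ⊎ e ∈ T₁ ⊎ e ∈ T₂
    ∈-E₁⁻ m = map₂ (∈-++⁻ T₁) (∈-++⁻ E m)

    R-nonempty : NonEmptySides (_∈ R)
    R-nonempty = oriented-nonempty oriented

    ne-u : NonEmpty u
    ne-u = steps-nonempty R-nonempty (proj₁ (eqns-nonempty (here refl))) l→u

    ne-v : NonEmpty v
    ne-v = steps-nonempty R-nonempty (proj₂ (eqns-nonempty (here refl))) r→v

    ρ-oriented : r′ ≺ l′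
    ρ-oriented = Orient-≺ o ne-u ne-v

    Rn-oriented : Oriented _≫_ Rn
    Rn-oriented (here refl) = ρ-oriented
    Rn-oriented (there k) = oriented (∈-Collapse-kept col k)

    R₁-oriented : Oriented _≫_ R₁
    R₁-oriented (here refl) = ρ-oriented
    R₁-oriented (there k′) with ∈-Compose⁻ cmp k′
    ... | _ , k , r₂→u₂ = ≺-steps Rn-oriented (Rn-oriented (there k)) r₂→u₂

    -- A step by a rule of K is replaced by its composed rule in K′ followed by
    -- the normalisation of the old right side, whose steps are smaller.
    Rn-step-connected : Acc _≺_ a → a ≺ t → Step Rn a b → ConnBelow New t a b
    Rn-step-connected _ a≺t s@(A , B , here refl , A⊆a , b≡) =
      link (A , B , ρ∈New , A⊆a , b≡) a≺t (≺-trans (step-≺ Rn-oriented s) a≺t)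
    Rn-step-connected {a} {t} (acc rs) a≺t s@(A , B , there k , A⊆a , refl) with ∈-Compose⁺ cmp k
    ... | u₂ , k′ , B→u₂ =
      link (A , u₂ , inj₁ (there k′) , A⊆a , refl) a≺t (≺-trans c≺a a≺t) ◅◅
      connBelow-sym (steps-connected Rn-oriented below-a b≺a b→c)
      where
      b≺a = step-≺ Rn-oriented s
      b→c = steps-ctx (a − A) B→u₂
      c≺a = ≺-steps Rn-oriented b≺a b→c
      below-a : x ≺ a → Step Rn x y → ConnBelow New t x y
      below-a x≺a = Rn-step-connected (rs x≺a) (≺-trans x≺a a≺t)

    Rn-steps-connected : a ≺ t → Steps Rn a b → ConnBelow New t a b
    Rn-steps-connected = steps-connected Rn-oriented (Rn-step-connected (≺-wellFounded _))

    R-step-connected : a ≺ t → Step R a b → ConnBelow New t a b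
    R-step-connected a≺t s@(A , B , m , A⊆a , b≡) with ∈-Collapse⁻ col m
    ... | inj₁ k = Rn-step-connected (≺-wellFounded _) a≺t (A , B , there k , A⊆a , b≡)
    ... | inj₂ removed =
      link (A , B , inj₂ (∈-++⁺ʳ E (∈-++⁺ʳ T₁ removed)) , A⊆a , b≡) a≺t (≺-trans (step-≺ oriented s) a≺t)

    R-steps-connected : a ≺ t → Steps R a b → ConnBelow New t a b
    R-steps-connected = steps-connected oriented R-step-connected

    ρ-connects : (C : Mset n) → C ∪ u ≺ t → C ∪ v ≺ t → ConnBelow New t (C ∪ u) (C ∪ v)
    ρ-connects {t} C u≺t v≺t =
      Orient⁻ (λ a b → ConnBelow New t (C ∪ a) (C ∪ b)) connBelow-sym o
        (link (rule-step C ρ∈New) (proj₁ bounds) (proj₂ bounds))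
      where
      bounds : C ∪ l′ ≺ t × C ∪ r′ ≺ t
      bounds = Orient⁺ (λ a b → C ∪ a ≺ t × C ∪ b ≺ t) swap o (u≺t , v≺t)

    old-simulated : Simulates (R ⊕ ((l , r) ∷ E)) New
    old-simulated (s , a≺t , b≺t) with stepView s
    ... | ctx C (inj₁ m) = R-step-connected a≺t (rule-step C m)
    ... | ctx C (inj₂ (there m)) = link (rule-step C (inj₂ (∈-++⁺ˡ m))) a≺t b≺t
    ... | ctx C (inj₂ (here refl)) =
      R-steps-connected a≺t Cl→Cu ◅◅
      ρ-connects C (≺-steps oriented a≺t Cl→Cu) (≺-steps oriented b≺t Cr→Cv) ◅◅
      connBelow-sym (R-steps-connected b≺t Cr→Cv)
      where
      Cl→Cu = steps-ctx C l→u
      Cr→Cv = steps-ctx C r→v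

    critical-peak : Step R t x → l′ ⊆ t → ConnBelow New t x ((t − l′) ∪ r′)
    critical-peak {t} s@(A , B , m , A⊆t , refl) l′⊆t with ∈-CPs⁺ cps m
    ... | u₁ , u₂ , p₁ , p₂ , joined =
      subst₂ (ConnBelow New t) (sym e₁) (sym e₂)
        (R-steps-connected x≺t Cp₁ ◅◅ middle joined ◅◅ connBelow-sym (R-steps-connected y≺t Cp₂))
      where
      L = lcm A l′
      C = t − L
      e₁ : (t − A) ∪ B ≡ C ∪ ((L − A) ∪ B)
      e₁ = [M−A]∪B≡[M−L]∪[L−A∪B] B (⊆-lcmˡ A l′) (lcm-least {A = A} {l′} {t} A⊆t l′⊆t)
      e₂ : (t − l′) ∪ r′ ≡ C ∪ ((L − l′) ∪ r′)
      e₂ = [M−A]∪B≡[M−L]∪[L−A∪B] r′ (⊆-lcmʳ A l′) (lcm-least {A = A} {l′} {t} A⊆t l′⊆t)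
      x≺t = subst (_≺ t) e₁ (step-≺ oriented s)
      y≺t = subst (_≺ t) e₂ (step-≺ Rn-oriented (l′ , r′ , here refl , l′⊆t , refl))
      Cp₁ = steps-ctx C p₁
      Cp₂ = steps-ctx C p₂
      middle : u₁ ≡ u₂ ⊎ (u₁ , u₂) ∈ T₁ → ConnBelow New t (C ∪ u₁) (C ∪ u₂)
      middle (inj₁ refl) = ε
      middle (inj₂ eq) = link (rule-step C (inj₂ (∈-++⁺ʳ E (∈-++⁺ˡ eq))))
                              (≺-steps oriented x≺t Cp₁) (≺-steps oriented y≺t Cp₂)

    R₁-step-view : Step R₁ t x →
                   (l′ ⊆ t × x ≡ (t − l′) ∪ r′) ⊎ ∃ λ x₀ → Step R t x₀ × Steps Rn x₀ x
    R₁-step-view (_ , _ , here refl , l′⊆t , x≡) = inj₁ (l′⊆t , x≡)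
    R₁-step-view {t} (A , _ , there k′ , A⊆t , refl) with ∈-Compose⁻ cmp k′
    ... | B , k , B→u₂ =
      inj₂ (_ , (A , B , ∈-Collapse-kept col k , A⊆t , refl) , steps-ctx (t − A) B→u₂)

    after-R-step : Step R t a → Steps Rn a b → ConnBelow New t a b
    after-R-step s = Rn-steps-connected (step-≺ oriented s)

    R₁-peaks : Step R₁ t x → Step R₁ t y → ConnBelow New t x y
    R₁-peaks s₁ s₂ with R₁-step-view s₁ | R₁-step-view s₂
    ... | inj₁ (_ , refl) | inj₁ (_ , refl) = ε
    ... | inj₂ (_ , s , a→x) | inj₁ (l′⊆t , refl) =
      connBelow-sym (after-R-step s a→x) ◅◅ critical-peak s l′⊆t
    ... | inj₁ (l′⊆t , refl) | inj₂ (_ , s , b→y) =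
      connBelow-sym (critical-peak s l′⊆t) ◅◅ after-R-step s b→y
    ... | inj₂ (_ , s , a→x) | inj₂ (_ , s′ , b→y) =
      connBelow-sym (after-R-step s a→x) ◅◅
      simulate-connBelow old-simulated (peaks s s′) ◅◅
      after-R-step s′ b→y

    R-sound : Sound E₀ (_∈ R)
    R-sound = sound ∘ inj₁

    ρ-sound : ACCC E₀ l′ r′
    ρ-sound = Orient⁺ (ACCC E₀) ACCC.sym o
      (ACCC.trans (ACCC.sym (steps-sound E₀ R-sound ne-u l→u))
        (ACCC.trans (sound (inj₂ (here refl))) (steps-sound E₀ R-sound ne-v r→v)))

    Rn-sound : Sound E₀ (_∈ Rn)
    Rn-sound (here refl) = ρ-sound
    Rn-sound (there k) = R-sound (∈-Collapse-kept col k)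

    -- A critical pair is joined through the overlap lcm A l′ of the two left sides.
    critical-equation : {u₁ u₂ : Mset n} → (u₁ , u₂) ∈ T₁ →
                        (NonEmpty u₁ × NonEmpty u₂) × ACCC E₀ u₁ u₂
    critical-equation eq with ∈-CPs⁻ cps eq
    ... | (A , B) , m , p₁ , p₂ =
      (ne-u₁ , ne-u₂) ,
      ACCC.trans (ACCC.sym (steps-sound E₀ R-sound ne-u₁ p₁))
        (ACCC.trans (ACCC.trans (ACCC.sym (step-sound E₀ R-sound σ-step)) (step-sound E₀ Rn-sound ρ-step))
          (steps-sound E₀ R-sound ne-u₂ p₂))
      where
      L = lcm A l′
      σ-step : Step R L ((L − A) ∪ B)
      σ-step = A , B , m , ⊆-lcmˡ A l′ , refl
      ρ-step : Step Rn L ((L − l′) ∪ r′)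
      ρ-step = l′ , r′ , here refl , ⊆-lcmʳ A l′ , refl
      ne-u₁ = steps-nonempty R-nonempty (proj₂ (step-nonempty R-nonempty σ-step)) p₁
      ne-u₂ = steps-nonempty R-nonempty (proj₂ (step-nonempty (oriented-nonempty Rn-oriented) ρ-step)) p₂

    E₁-nonempty : NonEmptySides (_∈ E₁)
    E₁-nonempty m with ∈-E₁⁻ m
    ... | inj₁ old = eqns-nonempty (there old)
    ... | inj₂ (inj₁ critical) = proj₁ (critical-equation critical)
    ... | inj₂ (inj₂ removed) = R-nonempty (∈-Collapse-removed col removed)

    New-sound : Sound E₀ New
    New-sound (inj₁ (here refl)) = ρ-sound
    New-sound (inj₁ (there k′)) with ∈-Compose⁻ cmp k′
    ... | _ , k , r₂→u₂ =
      ACCC.trans (Rn-sound (there k))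
        (steps-sound E₀ Rn-sound (proj₁ (proj₂ (R₁-oriented (there k′)))) r₂→u₂)
    New-sound (inj₂ m) with ∈-E₁⁻ m
    ... | inj₁ old = sound (inj₂ (there old))
    ... | inj₂ (inj₁ critical) = proj₂ (critical-equation critical)
    ... | inj₂ (inj₂ removed) = R-sound (∈-Collapse-removed col removed)

    invariant : Invariant R₁ E₁
    invariant = record
      { oriented      = R₁-oriented
      ; eqns-nonempty = E₁-nonempty
      ; peaks         = R₁-peaks
      ; sound         = New-sound
      ; complete      = simulate-conv (⊕-nonempty oriented eqns-nonempty) old-simulated ∘ complete
      }

  process-invariant : {R₁ : System n} → Invariant R (e ∷ E) → Process _≫_ R e R₁ T₁ →
                      Invariant R₁ (E ++ T₁)
  process-invariant {E = E} I (trivial nf-l nf-r) =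
    subst (Invariant _) (sym (++-identityʳ E)) (Trivial.invariant I (proj₁ nf-l) (proj₁ nf-r))
  process-invariant I (orient nf-l nf-r _ o cps col cmp) =
    Orientation.invariant I (proj₁ nf-l) (proj₁ nf-r) o cps col cmp

  loop-invariant : Invariant R (S ++ T) → Loop _≫_ R S T R′ → Invariant R′ []
  loop-invariant I done = I
  loop-invariant {T = T} I (pass L) = loop-invariant (subst (Invariant _) (sym (++-identityʳ T)) I) L
  loop-invariant {R = R} {T = T} I (pick {S' = S′} {T₁ = T₁} S↭eS′ process L) =
    loop-invariant (subst (Invariant _) (++-assoc S′ T T₁) (process-invariant I′ process)) L
    where
    I′ : Invariant R (_ ∷ S′ ++ T)
    I′ = Invariant-resp-↭ (++⁺ʳ T S↭eS′) I

  module Result {R : System n} (I : Invariant R []) where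

    open Invariant I

    rules-only : ∀ {e} → (R ⊕ []) e → e ∈ R
    rules-only (inj₁ m) = m
    rules-only (inj₂ ())

    canonical : Canonical _≫_ R
    canonical =
      oriented , terminating oriented , confluent oriented (λ s₁ s₂ → connBelow-map rules-only (peaks s₁ s₂))

    ACCC⇒SameNF : NonEmpty s → ACCC E₀ s t → SameNF R s t
    ACCC⇒SameNF ne-s p
      with conv-joinable (oriented-nonempty oriented) (proj₂ (proj₂ canonical)) ne-s
             (EqClosure.map (stepBy-map rules-only) (ACCC⇒conv complete p))
    ... | z , s→z , t→z
      with normal-form (terminating oriented z (steps-nonempty (oriented-nonempty oriented) ne-s s→z))
    ...   | w , z→w , irreducible = w , (s→z ◅◅ z→w , irreducible) , (t→z ◅◅ z→w , irreducible)

    SameNF⇒ACCC : NonEmpty s → SameNF R s t → ACCC E₀ s t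
    SameNF⇒ACCC ne-s (w , (s→w , _) , (t→w , _)) =
      ACCC.trans (steps-sound E₀ (sound ∘ inj₁) ne-w s→w)
        (ACCC.sym (steps-sound E₀ (sound ∘ inj₁) ne-w t→w))
      where ne-w = steps-nonempty (oriented-nonempty oriented) ne-s s→w

-- The state after splitting R_f

module Initial {n : ℕ} {_>C_ : Rel (Fin n) 0ℓ} (_≫_ : Rel (Mset n) 0ℓ) (adm : Admissible _≫_)
    (extends : Extends _>C_ _≫_) {Rf : System n} (Rf-canonical : Canonical _≫_ Rf)
    {RC : List (Fin n × Fin n)} (RC-canonical : CanonicalConst _>C_ RC)
    {K : System n} {S : List (Eqn n)} (split : Split (constSys RC) Rf K S) where

  open Rewriting _≫_ adm
  open Completion _≫_ adm (Rf ++ constSys RC)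

  R₀ : System n
  R₀ = constSys RC ++ K

  private variable
    A A′ B B′ t : Mset n
    c d₁ d₂ : Fin n

  data R₀-rule : Rule n → Set where
    const : ∀ {c d} → (c , d) ∈ RC → R₀-rule (single c , single d)
    kept  : ∀ {l r} → (l , r) ∈ K → R₀-rule (l , r)

  R₀-rule⁻ : ∀ {e} → e ∈ R₀ → R₀-rule e
  R₀-rule⁻ m with ∈-++⁻ (constSys RC) m
  ... | inj₂ k = kept k
  ... | inj₁ m′ with ∈-map⁻ _ m′
  ...   | _ , cd , refl = const cd

  const∈R₀ : ∀ {c d} → (c , d) ∈ RC → (single c , single d) ∈ R₀
  const∈R₀ cd = ∈-++⁺ˡ (∈-map⁺ _ cd)

  Rf-oriented : Oriented _≫_ Rf
  Rf-oriented = proj₁ Rf-canonical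

  R₀-oriented : Oriented _≫_ R₀
  R₀-oriented m with R₀-rule⁻ m
  ... | const {c} {d} cd = NonEmpty-single c , NonEmpty-single d , proj₁ (extends c d) (proj₁ RC-canonical cd)
  ... | kept k = Rf-oriented (proj₁ (∈-Split-kept split k))

  Rf-in : ∀ {l r} → (l , r) ∈ Rf → (R₀ ⊕ S) (l , r)
  Rf-in m with ∈-Split⁻ split m
  ... | inj₁ k = inj₁ (∈-++⁺ʳ (constSys RC) k)
  ... | inj₂ moved = inj₂ moved

  kept-const-free : ∀ {c d} → (A , A′) ∈ K → (c , d) ∈ RC → ¬ single c ⊆ A
  kept-const-free k cd c⊆A = proj₂ (∈-Split-kept split k) (_ , _ , _ , ∈-map⁺ _ cd , c⊆A , refl)

  kept-peak : (A , A′) ∈ K → (B , B′) ∈ K → A ⊆ t → B ⊆ t →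
              ConnBelow (R₀ ⊕ S) t ((t − A) ∪ A′) ((t − B) ∪ B′)
  kept-peak {A} {A′} {B} {B′} {t} k₁ k₂ A⊆t B⊆t
    with proj₂ (proj₂ Rf-canonical) ne-t (t⇒x ◅ ε) (t⇒y ◅ ε)
    where
    t⇒x : Step Rf t ((t − A) ∪ A′)
    t⇒x = A , A′ , proj₁ (∈-Split-kept split k₁) , A⊆t , refl
    t⇒y : Step Rf t ((t − B) ∪ B′)
    t⇒y = B , B′ , proj₁ (∈-Split-kept split k₂) , B⊆t , refl
    ne-t = proj₁ (step-nonempty (oriented-nonempty Rf-oriented) t⇒x)
  ... | z , x→z , y→z =
    steps-connBelow Rf-oriented Rf-in x≺t x→z ◅◅ connBelow-sym (steps-connBelow Rf-oriented Rf-in y≺t y→z)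
    where
    x≺t = step-≺ Rf-oriented (A , A′ , proj₁ (∈-Split-kept split k₁) , A⊆t , refl)
    y≺t = step-≺ Rf-oriented (B , B′ , proj₁ (∈-Split-kept split k₂) , B⊆t , refl)

  const-steps : (C : Mset n) → Star (ConstStep RC) d₁ d₂ → Steps R₀ (C ∪ single d₁) (C ∪ single d₂)
  const-steps C = Star.gmap (λ d → C ∪ single d) (rule-step C ∘ const∈R₀)

  const-peak : (c , d₁) ∈ RC → (c , d₂) ∈ RC → single c ⊆ t →
               ConnBelow (R₀ ⊕ S) t ((t − single c) ∪ single d₁) ((t − single c) ∪ single d₂)
  const-peak {c} {d₁} {d₂} {t} cd₁ cd₂ c⊆t with proj₂ (proj₂ RC-canonical) (cd₁ ◅ ε) (cd₂ ◅ ε)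
  ... | e , d₁→e , d₂→e =
    steps-connBelow R₀-oriented inj₁ (x≺t cd₁) (const-steps (t − single c) d₁→e) ◅◅
    connBelow-sym (steps-connBelow R₀-oriented inj₁ (x≺t cd₂) (const-steps (t − single c) d₂→e))
    where
    x≺t : ∀ {d} → (c , d) ∈ RC → (t − single c) ∪ single d ≺ t
    x≺t cd = step-≺ R₀-oriented (single c , single _ , const∈R₀ cd , c⊆t , refl)

  disjoint : (A , A′) ∈ R₀ → (B , B′) ∈ R₀ → A ∪ B ⊆ t →
             ConnBelow (R₀ ⊕ S) t ((t − A) ∪ A′) ((t − B) ∪ B′)
  disjoint m₁ m₂ AB⊆t = connBelow-map inj₁ (disjoint-peak R₀-oriented m₁ m₂ AB⊆t)

  R₀-peaks : ∀ {t x y} → Step R₀ t x → Step R₀ t y → ConnBelow (R₀ ⊕ S) t x y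
  R₀-peaks {t} (A , A′ , m₁ , A⊆t , refl) (B , B′ , m₂ , B⊆t , refl) with R₀-rule⁻ m₁ | R₀-rule⁻ m₂
  ... | kept k₁ | kept k₂ = kept-peak k₁ k₂ A⊆t B⊆t
  ... | const {c} cd | kept k = disjoint m₁ m₂ (single∪⊆ c {B} {t} A⊆t B⊆t (kept-const-free k cd))
  ... | kept k | const {c} cd =
    connBelow-sym (disjoint m₂ m₁ (single∪⊆ c {A} {t} B⊆t A⊆t (kept-const-free k cd)))
  ... | const {c} cd₁ | const {c′} cd₂ with c ≟ c′
  ...   | yes refl = const-peak cd₁ cd₂ A⊆t
  ...   | no c≢c′ = disjoint m₁ m₂ (single∪⊆ c {B} {t} A⊆t B⊆t (c≢c′ ∘ single⊆single⇒≡))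

  R₀-sound : ∀ {l r} → (l , r) ∈ R₀ → (l , r) ∈ Rf ++ constSys RC
  R₀-sound m with ∈-++⁻ (constSys RC) m
  ... | inj₁ c = ∈-++⁺ʳ Rf c
  ... | inj₂ k = ∈-++⁺ˡ (proj₁ (∈-Split-kept split k))

  E₀-in : ∀ {l r} → (l , r) ∈ Rf ++ constSys RC → (R₀ ⊕ S) (l , r)
  E₀-in m with ∈-++⁻ Rf m
  ... | inj₁ f = Rf-in f
  ... | inj₂ c = inj₁ (∈-++⁺ˡ c)

  invariant : Invariant R₀ S
  invariant = record
    { oriented      = R₀-oriented
    ; eqns-nonempty = oriented-nonempty Rf-oriented ∘ ∈-Split-moved split
    ; peaks         = R₀-peaks
    ; sound         = λ { (inj₁ m) → ACCC.base (R₀-sound m)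
                        ; (inj₂ m) → ACCC.base (∈-++⁺ˡ (∈-Split-moved split m)) }
    ; complete      = EqClosure.return ∘ rule-stepBy ∘ E₀-in
    }

theorem6p2 : ∀ {n : ℕ} (_>C_ : Rel (Fin n) 0ℓ) (_≫_ : Rel (Mset n) 0ℓ) →
    StrictTotal _>C_ → Admissible _≫_ → Extends _>C_ _≫_ → ConstantsLowest _≫_ →
    (Rf : System n) → Canonical _≫_ Rf →
    (RC : List (Fin n × Fin n)) → CanonicalConst _>C_ RC →
    (R' : System n) → UpdateAC _≫_ Rf RC R' →
    Canonical _≫_ R' ×
    (∀ s t → NonEmpty s → NonEmpty t →
      (ACCC (Rf ++ constSys RC) s t → SameNF R' s t) ×
      (SameNF R' s t → ACCC (Rf ++ constSys RC) s t))
theorem6p2 _>C_ _≫_ _ adm extends _ Rf Rf-canonical RC RC-canonical R′ (K , S , split , loop) =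
  canonical , λ s t ne-s _ → ACCC⇒SameNF ne-s , SameNF⇒ACCC ne-s
  where
  open Completion _≫_ adm (Rf ++ constSys RC)
  initial : Invariant (constSys RC ++ K) (S ++ [])
  initial = subst (Invariant _) (sym (++-identityʳ S))
              (Initial.invariant _≫_ adm extends Rf-canonical RC-canonical split)
  open Result (loop-invariant initial loop)
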